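{- For every positive integer $a$, $R_3(a(x-y)=(a-1)z)\ge a^3+(a-1)^2$.
   Context: For a linear equation $\mathcal{E}$, the $3$-color Rado number $R_3(\mathcal{E})$ is the smallest positive integer $n$ such that every coloring of $\{1,\dots,n\}$ with $3$ colors admits a monochromatic solution to $\mathcal{E}$ with all variables in $\{1,\dots,n\}$, or $\infty$ if no such $n$ exists. -}

module Defs where

open import Data.Nat using (ℕ; _+_; _*_; _∸_; _≤_)
open import Data.Fin using (Fin)
open import Data.Product using (Σ; _×_)
open import Relation.Binary.PropositionalEquality using (_≡_)

InRange : ℕ → ℕ → Set
InRange n x = (1 ≤ x) × (x ≤ n)

-- The equation a(x - y) = (a - 1) z, written over ℕ as  a x = a y + (a - 1) z
-- (equivalent over the integers for a ≥ 1, since a - 1 = a ∸ 1 then).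
Eqn : ℕ → ℕ → ℕ → ℕ → Set
Eqn a x y z = a * x ≡ a * y + (a ∸ 1) * z

HasMonoSol : ℕ → ℕ → (ℕ → Fin 3) → Set
HasMonoSol a n c =
  Σ ℕ λ x → Σ ℕ λ y → Σ ℕ λ z →
    InRange n x × InRange n y × InRange n z ×
    c x ≡ c y × c y ≡ c z × Eqn a x y z

RadoProp3 : ℕ → ℕ → Set
RadoProp3 a n = (c : ℕ → Fin 3) → HasMonoSol a n c

-- R_3(E) ≥ B  (R_3 being the least n with the Rado property, or ∞):
-- every n with the Rado property satisfies B ≤ n.
R3≥ : ℕ → ℕ → Set
R3≥ a B = (n : ℕ) → RadoProp3 a n → B ≤ n

-- Write a = m + 1. Since a and m are coprime, every solution of a x = a y + m z has
-- z = t a and x = y + m t. Colour the non-multiples of a by 0 if they lie below a m or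
-- within a of a³ and by 2 otherwise, the multiples of a but not of a² by 1, and the
-- multiples of a² by 0 below a³ and by 2 from a³ on. Colour 1 is solution-free because
-- dividing a solution by a gives a ∣ z / a. In colours 0 and 2 we get z = q a², so x ≡ y
-- (mod a) and the shift m t = m q a lies in [m a, m a²] (colour 0) or is ≥ m a² (colour 2);
-- by a³ = a m + m a² + a such a shift always leaves the colour class or pushes x to
-- a³ + m² or beyond.

module Submission where

open import Defs
open import Data.Nat
  using (ℕ; suc; _+_; _*_; _∸_; _^_; _≤_; _<_; z<s; NonZero; >-nonZero; _≤?_; _<?_)
open import Data.Nat.Properties
open import Data.Nat.Divisibility
  using (_∣_; _∤_; divides; _∣?_; ∣m+n∣m⇒∣n; ∣m∣n⇒∣m+n; m∣m*n; m*n∣⇒m∣; ∣⇒≤)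
open import Data.Nat.Tactic.RingSolver using (solve-∀)
open import Data.Fin using (Fin)
open import Data.Fin.Patterns using (0F; 1F; 2F)
open import Data.Product using (_×_; _,_)
open import Data.Sum using (_⊎_; inj₁; inj₂)
open import Data.Empty using (⊥)
open import Relation.Nullary using (¬_; yes; no)
open import Relation.Binary.PropositionalEquality
open import Algebra.Properties.CommutativeSemigroup +-commutativeSemigroup using (xy∙z≈xz∙y)

1+m∣m*n⇒1+m∣n : ∀ m {n} → suc m ∣ m * n → suc m ∣ n
1+m∣m*n⇒1+m∣n m {n} = ∣m+n∣m⇒∣n (subst (suc m ∣_) (+-comm n (m * n)) (m∣m*n n))

∣-+-transfer : ∀ {d x y k} → x ≡ y + k → d ∣ k → d ∣ x → d ∣ y
∣-+-transfer {d} {x} {y} {k} x≡y+k d∣k d∣x =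
  ∣m+n∣m⇒∣n (subst (d ∣_) (trans x≡y+k (+-comm y k)) d∣x) d∣k

∣-+-transfer⁻¹ : ∀ {d x y k} → x ≡ y + k → d ∣ k → d ∣ y → d ∣ x
∣-+-transfer⁻¹ {d} x≡y+k d∣k d∣y = subst (d ∣_) (sym x≡y+k) (∣m∣n⇒∣m+n d∣y d∣k)

eqn⇒a∣z : ∀ {m x y z} → Eqn (suc m) x y z → suc m ∣ z
eqn⇒a∣z {m} {x} {y} e =
  1+m∣m*n⇒1+m∣n m (∣m+n∣m⇒∣n (subst (suc m ∣_) e (m∣m*n x)) (m∣m*n y))

eqn⇒x≡y+m*t : ∀ {m x y t} → Eqn (suc m) x y (t * suc m) → x ≡ y + m * t
eqn⇒x≡y+m*t {m} {x} {y} {t} e =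
  *-cancelˡ-≡ x (y + m * t) (suc m) (trans e (regroup (suc m) y m t))
  where
  regroup : ∀ a y m t → a * y + m * (t * a) ≡ a * (y + m * t)
  regroup = solve-∀

eqn-cancelʳ : ∀ {a x y z} k .{{_ : NonZero k}} → Eqn a (x * k) (y * k) (z * k) → Eqn a x y z
eqn-cancelʳ {a} {x} {y} {z} k e =
  *-cancelʳ-≡ (a * x) (a * y + (a ∸ 1) * z) k
    (trans (sym (regroup₁ a x k)) (trans e (regroup₂ a y (a ∸ 1) z k)))
  where
  regroup₁ : ∀ a x k → a * (x * k) ≡ a * x * k
  regroup₁ = solve-∀
  regroup₂ : ∀ a y c z k → a * (y * k) + c * (z * k) ≡ (a * y + c * z) * k
  regroup₂ = solve-∀

module Colouring (m : ℕ) where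

  a : ℕ
  a = suc m

  B : ℕ
  B = a ^ 3 + m ^ 2

  Low High : ℕ → Set
  Low n = n < a * m
  High n = a ^ 3 < n + a

  Class : Fin 3 → ℕ → Set
  Class 0F n = (a ∤ n × (Low n ⊎ High n)) ⊎ (a * a ∣ n × n < a ^ 3)
  Class 1F n = a ∣ n × a * a ∤ n
  Class 2F n = (a ∤ n × a * m < n × ¬ High n) ⊎ (a * a ∣ n × a ^ 3 ≤ n)

  ¬Low⇒a*m< : ∀ {n} → a ∤ n → ¬ Low n → a * m < n
  ¬Low⇒a*m< a∤n ¬low =
    ≤∧≢⇒< (≮⇒≥ ¬low) (λ am≡n → a∤n (divides m (trans (sym am≡n) (*-comm a m))))

  colour : ℕ → Fin 3
  colour n with a ∣? n | a * a ∣? n | n <? a * m | a ^ 3 <? n + a | a ^ 3 ≤? n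
  ... | no _  | _     | yes _ | _     | _     = 0F
  ... | no _  | _     | no _  | yes _ | _     = 0F
  ... | no _  | _     | no _  | no _  | _     = 2F
  ... | yes _ | no _  | _     | _     | _     = 1F
  ... | yes _ | yes _ | _     | _     | no _  = 0F
  ... | yes _ | yes _ | _     | _     | yes _ = 2F

  colour-class : ∀ n → Class (colour n) n
  colour-class n with a ∣? n | a * a ∣? n | n <? a * m | a ^ 3 <? n + a | a ^ 3 ≤? n
  ... | no a∤n  | _       | yes low | _        | _     = inj₁ (a∤n , inj₁ low)
  ... | no a∤n  | _       | no ¬low | yes high | _     = inj₁ (a∤n , inj₂ high)
  ... | no a∤n  | _       | no ¬low | no ¬high | _     =
    inj₁ (a∤n , ¬Low⇒a*m< a∤n ¬low , ¬high)
  ... | yes a∣n | no a²∤n | _       | _        | _     = a∣n , a²∤n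
  ... | yes _   | yes a²∣n | _      | _        | no ¬top = inj₂ (a²∣n , ≰⇒> ¬top)
  ... | yes _   | yes a²∣n | _      | _        | yes top = inj₂ (a²∣n , top)

  cube-split : a * m + m * (a * a) + a ≡ a ^ 3
  cube-split = split m
    where
    -- _^_ is unfolded by hand: the ring solver does not support it.
    split : ∀ m → suc m * m + m * (suc m * suc m) + suc m ≡ suc m * (suc m * (suc m * 1))
    split = solve-∀

  a³≡a*a² : a ^ 3 ≡ a * (a * a)
  a³≡a*a² = cong (λ k → a * (a * k)) (*-identityʳ a)

  module _ {x y t : ℕ} (x≡y+mt : x ≡ y + m * t) where

    x+a≡y+mt+a : x + a ≡ y + m * t + a
    x+a≡y+mt+a = cong (_+ a) x≡y+mt

    shift-not-low : a ≤ t → ¬ Low x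
    shift-not-low a≤t low-x = <⇒≱ low-x (begin
      a * m      ≡⟨ *-comm a m ⟩
      m * a      ≤⟨ *-monoʳ-≤ m a≤t ⟩
      m * t      ≤⟨ m≤n+m (m * t) y ⟩
      y + m * t  ≡⟨ x≡y+mt ⟨
      x          ∎)
      where open ≤-Reasoning

    shift-≥B : a ≤ t → High y → B ≤ x
    shift-≥B a≤t high-y = +-cancelʳ-≤ a B x (begin
      B + a                    ≡⟨ regroup m ⟩
      suc (a ^ 3) + m * a      ≤⟨ +-mono-≤ high-y (*-monoʳ-≤ m a≤t) ⟩
      y + a + m * t            ≡⟨ xy∙z≈xz∙y y a (m * t) ⟩
      y + m * t + a            ≡⟨ x+a≡y+mt+a ⟨
      x + a                    ∎)
      where
      open ≤-Reasoning
      regroup : ∀ m → suc m * (suc m * (suc m * 1)) + m * (m * 1) + suc m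
                ≡ suc (suc m * (suc m * (suc m * 1))) + m * suc m
      regroup = solve-∀

    shift-not-high : Low y → t ≤ a * a → ¬ High x
    shift-not-high low-y t≤a² = ≤⇒≯ (<⇒≤ (begin-strict
      x + a                    ≡⟨ x+a≡y+mt+a ⟩
      y + m * t + a            <⟨ +-monoˡ-< a (+-mono-<-≤ low-y (*-monoʳ-≤ m t≤a²)) ⟩
      a * m + m * (a * a) + a  ≡⟨ cube-split ⟩
      a ^ 3                    ∎))
      where open ≤-Reasoning

    shift-high : a * m < y → a * a ≤ t → High x
    shift-high am<y a²≤t = begin-strict
      a ^ 3                    ≡⟨ cube-split ⟨
      a * m + m * (a * a) + a  <⟨ +-monoˡ-< a (+-mono-<-≤ am<y (*-monoʳ-≤ m a²≤t)) ⟩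
      y + m * t + a            ≡⟨ x+a≡y+mt+a ⟨
      x + a                    ∎
      where open ≤-Reasoning

  a∣m*[q*a] : ∀ q → a ∣ m * (q * a)
  a∣m*[q*a] q = divides (m * q) (sym (*-assoc m q a))

  a²∣z-shift : ∀ {x y q} → Eqn a x y (q * (a * a)) → x ≡ y + m * (q * a)
  a²∣z-shift {x} {y} {q} e =
    eqn⇒x≡y+m*t {m} {x} {y} (subst (Eqn a x y) (sym (*-assoc q a a)) e)

  module _ (q : ℕ) where

    multiplier>0 : 1 ≤ q * (a * a) → 0 < q
    multiplier>0 = *-cancelʳ-< (a * a) 0 q

    multiplier<a : q * (a * a) < a ^ 3 → q < a
    multiplier<a z<a³ = *-cancelʳ-< (a * a) q a (subst (q * (a * a) <_) a³≡a*a² z<a³)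

    a≤multiplier : a ^ 3 ≤ q * (a * a) → a ≤ q
    a≤multiplier a³≤z = *-cancelʳ-≤ a q (a * a) (subst (_≤ q * (a * a)) a³≡a*a² a³≤z)

  a²∣⇒a∣ : ∀ {n} → a * a ∣ n → a ∣ n
  a²∣⇒a∣ = m*n∣⇒m∣ a a

  ≥a³⇒High : ∀ {n} → a ^ 3 ≤ n → High n
  ≥a³⇒High {n} a³≤n = ≤-<-trans a³≤n (m<m+n n z<s)

  class₀-free : ∀ {x y z} → Class 0F x → Class 0F y → Class 0F z →
                1 ≤ z → x < B → Eqn a x y z → ⊥
  class₀-free _ _ (inj₁ (a∤z , _)) _ _ e = a∤z (eqn⇒a∣z {m} e)
  class₀-free (inj₂ (divides qx refl , _)) (inj₂ (divides qy refl , _))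
              (inj₂ (divides q refl , z<a³)) 1≤z _ e =
    <⇒≱ (multiplier<a q z<a³) (∣⇒≤ {{>-nonZero (multiplier>0 q 1≤z)}} a∣q)
    where
    a∣q : a ∣ q
    a∣q = eqn⇒a∣z {m} (eqn-cancelʳ {a} {qx} {qy} {q} (a * a) e)
  class₀-free {x} {y} (inj₁ (a∤x , _)) (inj₂ (a²∣y , _)) (inj₂ (divides q refl , _)) _ _ e =
    a∤x (∣-+-transfer⁻¹ (a²∣z-shift {x} {y} {q} e) (a∣m*[q*a] q) (a²∣⇒a∣ a²∣y))
  class₀-free {x} {y} (inj₂ (a²∣x , _)) (inj₁ (a∤y , _)) (inj₂ (divides q refl , _)) _ _ e =
    a∤y (∣-+-transfer (a²∣z-shift {x} {y} {q} e) (a∣m*[q*a] q) (a²∣⇒a∣ a²∣x))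
  class₀-free {x} {y} (inj₁ (_ , low-or-high-x)) (inj₁ (_ , low-or-high-y))
              (inj₂ (divides q refl , z<a³)) 1≤z x<B e =
    spread low-or-high-x low-or-high-y
    where
    x≡y+mt : x ≡ y + m * (q * a)
    x≡y+mt = a²∣z-shift {x} {y} {q} e
    a≤t : a ≤ q * a
    a≤t = m≤n*m a q {{>-nonZero (multiplier>0 q 1≤z)}}
    t≤a² : q * a ≤ a * a
    t≤a² = *-monoˡ-≤ a (<⇒≤ (multiplier<a q z<a³))
    spread : Low x ⊎ High x → Low y ⊎ High y → ⊥
    spread (inj₁ low-x)  _              = shift-not-low x≡y+mt a≤t low-x
    spread (inj₂ high-x) (inj₁ low-y)  = shift-not-high x≡y+mt low-y t≤a² high-x
    spread (inj₂ _)      (inj₂ high-y) = <⇒≱ x<B (shift-≥B x≡y+mt a≤t high-y)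

  class₁-free : ∀ {x y z} → Class 1F x → Class 1F y → Class 1F z → Eqn a x y z → ⊥
  class₁-free (divides x′ refl , _) (divides y′ refl , _) (divides z′ refl , a²∤z) e
    with eqn⇒a∣z {m} (eqn-cancelʳ {a} {x′} {y′} {z′} a e)
  ... | divides r refl = a²∤z (divides r (*-assoc r a a))

  class₂-free : ∀ {x y z} → Class 2F x → Class 2F y → Class 2F z →
                x < B → Eqn a x y z → ⊥
  class₂-free _ _ (inj₁ (a∤z , _)) _ e = a∤z (eqn⇒a∣z {m} e)
  class₂-free {x} {y} _ (inj₂ (_ , a³≤y)) (inj₂ (divides q refl , a³≤z)) x<B e =
    <⇒≱ x<B (shift-≥B (a²∣z-shift {x} {y} {q} e) a≤t (≥a³⇒High a³≤y))
    where
    a≤t : a ≤ q * a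
    a≤t = ≤-trans (m≤m*n a a) (*-monoˡ-≤ a (a≤multiplier q a³≤z))
  class₂-free {x} {y} (inj₁ (_ , _ , ¬high-x)) (inj₁ (_ , am<y , _))
              (inj₂ (divides q refl , a³≤z)) _ e =
    ¬high-x (shift-high (a²∣z-shift {x} {y} {q} e) am<y (*-monoˡ-≤ a (a≤multiplier q a³≤z)))
  class₂-free {x} {y} (inj₂ (a²∣x , _)) (inj₁ (a∤y , _)) (inj₂ (divides q refl , _)) _ e =
    a∤y (∣-+-transfer (a²∣z-shift {x} {y} {q} e) (a∣m*[q*a] q) (a²∣⇒a∣ a²∣x))

  monochromatic-free : ∀ k {x y z} → Class k x → Class k y → Class k z →
                       1 ≤ z → x < B → Eqn a x y z → ⊥
  monochromatic-free 0F cx cy cz 1≤z x<B = class₀-free cx cy cz 1≤z x<B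
  monochromatic-free 1F cx cy cz _   _   = class₁-free cx cy cz
  monochromatic-free 2F cx cy cz _   x<B = class₂-free cx cy cz x<B

  colour-avoids-solutions : ∀ {n} → n < B → ¬ HasMonoSol a n colour
  colour-avoids-solutions n<B (x , y , z , (_ , x≤n) , _ , (1≤z , _) , cx≡cy , cy≡cz , e) =
    monochromatic-free (colour z)
      (subst (λ k → Class k x) (trans cx≡cy cy≡cz) (colour-class x))
      (subst (λ k → Class k y) cy≡cz (colour-class y))
      (colour-class z) 1≤z (≤-<-trans x≤n n<B) e

lemma7 : (a : ℕ) → 1 ≤ a → R3≥ a (a ^ 3 + (a ∸ 1) ^ 2)
lemma7 (suc m) _ n rado = ≮⇒≥ λ n<B → colour-avoids-solutions n<B (rado colour)
  where open Colouring m
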